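{- Let $G$ be a claw-free graph and let $G^0, G^1, \ldots, G^l$ be a sequence of graphs with $G^0=G$, $G^l=\mathrm{cl}(G)$, and such that for $1 \le i \le l$, $G^i$ is obtained from $G^{i-1}$ by local completion at an eligible vertex of $G^{i-1}$. Let $N(x_1,x_2,x_3;y_1,y_2,y_3)$ be an induced net of $\mathrm{cl}(G)$, let $R_0$ be the clique of $\mathrm{cl}(G)$ containing the triangle $x_1x_2x_3$, and for $1\le j\le 3$ let $R_j$ be the clique of $\mathrm{cl}(G)$ containing the edge $x_jy_j$. Then for each $i$ with $0 \le i \le l$ there exists an induced net $N^i = N(x_1^i,x_2^i,x_3^i;y_1^i,y_2^i,y_3^i)$ of $G^i$ such that (i) for $j=1,2,3$: $x_j^i \in \{x_j\} \cup (V(R_0)\cap \mathrm{LC}(\mathrm{cl}(G)))$ and $y_j^i \in \{x_j,y_j\} \cup (V(R_0\cup R_j) \cap \mathrm{LC}(\mathrm{cl}(G)))$; and (ii) $x_1x_2x_3$ is a triangle in $G$ if and only if $y_j^0 \in \{y_j\} \cup (V(R_j)\cap \mathrm{LC}(\mathrm{cl}(G)))$ for each $j=1,2,3$.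
   Context: All graphs are finite and simple. A graph is claw-free if it has no induced $K_{1,3}$. For a claw-free graph $G$, a vertex $v$ is locally connected if $G[N_G(v)]$ is connected; $\mathrm{LC}(G)$ is the set of locally connected vertices of $G$. The local completion at $v$ adds all edges between nonadjacent vertices of $N_G(v)$; $v$ is eligible if it is locally connected and $G[N_G(v)]$ is not complete. The closure $\mathrm{cl}(G)$ is obtained by repeatedly performing local completions at eligible vertices until none remains (it is uniquely defined and has the same vertex set as $G$). A clique is a maximal complete subgraph. A net is the graph with degree sequence $3,3,3,1,1,1$; $N(x_1,x_2,x_3;y_1,y_2,y_3)$ denotes an induced net on these six vertices with edges $x_1x_2,x_2x_3,x_3x_1,x_1y_1,x_2y_2,x_3y_3$. -}

module Defs where

open import Data.Nat using (ℕ; zero; suc)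
open import Data.Fin using (Fin; zero; suc; inject₁; fromℕ; toℕ)
open import Data.Fin.Subset using (Subset; _∈_; _∉_)
open import Data.Bool using (Bool; true; false; _∨_; _∧_; not)
open import Data.Product using (Σ; _×_; _,_; ∃)
open import Data.Sum using (_⊎_)
open import Data.Empty using (⊥)
open import Relation.Nullary using (¬_)
open import Relation.Nullary.Decidable using (⌊_⌋)
open import Relation.Binary.PropositionalEquality using (_≡_; _≢_)
open import Data.Fin.Properties using (_≟_)
open import Function.Bundles using (_⇔_)

record Graph (n : ℕ) : Set where
  field
    adj   : Fin n → Fin n → Bool
    adj-sym : ∀ u w → adj u w ≡ adj w u
    adj-irrefl : ∀ u → adj u u ≡ false
open Graph public

SameGraph : ∀ {n} → Graph n → Graph n → Set
SameGraph G H = ∀ u w → adj G u w ≡ adj H u w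

ClawFree : ∀ {n} → Graph n → Set
ClawFree G = ∀ a b c d →
  adj G a b ≡ true → adj G a c ≡ true → adj G a d ≡ true →
  b ≢ c → b ≢ d → c ≢ d →
  adj G b c ≡ false → adj G b d ≡ false → adj G c d ≡ false → ⊥

data PathIn {n} (G : Graph n) (P : Fin n → Set) : Fin n → Fin n → Set where
  here  : ∀ {u} → P u → PathIn G P u u
  there : ∀ {u w z} → P u → adj G u w ≡ true → PathIn G P w z → PathIn G P u z

Nbr : ∀ {n} → Graph n → Fin n → Fin n → Set
Nbr G v u = adj G v u ≡ true

LocallyConnected : ∀ {n} → Graph n → Fin n → Set
LocallyConnected G v = ∀ u w → Nbr G v u → Nbr G v w → PathIn G (Nbr G v) u w

NbhdComplete : ∀ {n} → Graph n → Fin n → Set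
NbhdComplete G v = ∀ u w → Nbr G v u → Nbr G v w → u ≢ w → adj G u w ≡ true

Eligible : ∀ {n} → Graph n → Fin n → Set
Eligible G v = LocallyConnected G v × ¬ NbhdComplete G v

localCompletion : ∀ {n} → Graph n → Fin n → Graph n
localCompletion {n} G v = record
  { adj = A
  ; adj-sym = symm
  ; adj-irrefl = irr }
  where
  open import Relation.Binary.PropositionalEquality using (refl; cong₂; sym)
  open import Data.Bool.Properties using (∧-comm)
  open import Relation.Nullary using (yes; no)
  eqsym : ∀ u w → not ⌊ u ≟ w ⌋ ≡ not ⌊ w ≟ u ⌋
  eqsym u w with u ≟ w | w ≟ u
  ... | yes _ | yes _ = refl
  ... | no _ | no _ = refl
  ... | yes p | no q = Data.Empty.⊥-elim (q (sym p))
    where import Data.Empty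
  ... | no p | yes q = Data.Empty.⊥-elim (p (sym q))
    where import Data.Empty
  A : Fin n → Fin n → Bool
  A u w = adj G u w ∨ (not ⌊ u ≟ w ⌋ ∧ (adj G v u ∧ adj G v w))
  symm : ∀ u w → A u w ≡ A w u
  symm u w = cong₂ _∨_ (Graph.adj-sym G u w)
                       (cong₂ _∧_ (eqsym u w) (∧-comm (adj G v u) (adj G v w)))
  irr : ∀ u → A u u ≡ false
  irr u with u ≟ u
  ... | yes _ rewrite Graph.adj-irrefl G u = refl
  ... | no p = Data.Empty.⊥-elim (p refl)
    where import Data.Empty

LocalCompletionStep : ∀ {n} → Graph n → Graph n → Set
LocalCompletionStep G H = Σ _ λ v → Eligible G v × SameGraph H (localCompletion G v)

-- G has no eligible vertex (the closure process has terminated).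
Closed : ∀ {n} → Graph n → Set
Closed G = ∀ v → ¬ Eligible G v

IsClique : ∀ {n} → Graph n → Subset n → Set
IsClique G S =
  (∀ u w → u ∈ S → w ∈ S → u ≢ w → adj G u w ≡ true) ×
  (∀ z → z ∉ S → ¬ (∀ u → u ∈ S → adj G z u ≡ true))

IsNet : ∀ {n} → Graph n → (x₁ x₂ x₃ y₁ y₂ y₃ : Fin n) → Set
IsNet G x₁ x₂ x₃ y₁ y₂ y₃ =
  x₁ ≢ x₂ × x₁ ≢ x₃ × x₂ ≢ x₃ × y₁ ≢ y₂ × y₁ ≢ y₃ × y₂ ≢ y₃ ×
  x₁ ≢ y₁ × x₁ ≢ y₂ × x₁ ≢ y₃ × x₂ ≢ y₁ × x₂ ≢ y₂ × x₂ ≢ y₃ ×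
  x₃ ≢ y₁ × x₃ ≢ y₂ × x₃ ≢ y₃ ×
  adj G x₁ x₂ ≡ true × adj G x₂ x₃ ≡ true × adj G x₃ x₁ ≡ true ×
  adj G x₁ y₁ ≡ true × adj G x₂ y₂ ≡ true × adj G x₃ y₃ ≡ true ×
  adj G x₁ y₂ ≡ false × adj G x₁ y₃ ≡ false ×
  adj G x₂ y₁ ≡ false × adj G x₂ y₃ ≡ false ×
  adj G x₃ y₁ ≡ false × adj G x₃ y₂ ≡ false ×
  adj G y₁ y₂ ≡ false × adj G y₁ y₃ ≡ false × adj G y₂ y₃ ≡ false

IsTriangle : ∀ {n} → Graph n → (a b c : Fin n) → Set
IsTriangle G a b c = adj G a b ≡ true × adj G b c ≡ true × adj G c a ≡ true

-- Walk the closure sequence backwards. An edge of a net of G^{i+1} missing from G^i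
-- joins two neighbours of the completion vertex v, and claw-freeness of G^i leaves only
-- two situations: v can replace the pendant vertex of that edge, or (when two triangle
-- edges at aⱼ are missing) the triangle vertex aⱼ. Local connectivity only grows along
-- the sequence, so v is locally connected in cl(G), where such vertices are simplicial;
-- hence v falls into R₀ or Rⱼ, which keeps the net inside the sets of (i). If x₁x₂x₃ is a
-- triangle of G it survives in every G^i, only pendant vertices are ever replaced, and
-- they stay in {yⱼ} ∪ (Rⱼ ∩ LC). Conversely, a triangle vertex other than xⱼ lies in
-- R₀ ∩ LC and pulls its pendant neighbour into R₀, which is incompatible with that
-- neighbour lying in {yⱼ} ∪ (Rⱼ ∩ LC).

module Submission where

open import Defs
open import Data.Nat using (ℕ; suc)
open import Data.Fin using (Fin; zero; suc; inject₁; fromℕ; toℕ)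
open import Data.Fin.Properties using (_≟_)
open import Data.Fin.Induction using (<-weakInduction; >-weakInduction)
open import Data.Fin.Subset using (Subset; _∈_)
open import Data.Fin.Subset.Properties using (_∈?_)
open import Data.Bool using (Bool; true; false; _∨_; _∧_; not)
open import Data.Bool.Properties
  using (∨-conicalˡ; ∧-conicalˡ; ∧-conicalʳ; ∨-zeroʳ) renaming (_≟_ to _≟ᵇ_)
open import Data.Product using (Σ; _×_; _,_; proj₁; proj₂)
open import Data.Sum using (_⊎_; inj₁; inj₂)
open import Data.Empty using (⊥; ⊥-elim)
open import Function using (_∘_; case_of_)
open import Function.Bundles using (_⇔_; mk⇔)
open import Relation.Nullary using (¬_; Dec; yes; no)
open import Relation.Nullary.Decidable using (⌊_⌋; _×-dec_; dec-false; isYes≗does)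
open import Relation.Binary.PropositionalEquality
  using (_≡_; _≢_; refl; sym; trans; cong; cong₂; subst; ≢-sym; module ≡-Reasoning)

Edge NonEdge : ∀ {n} → Graph n → Fin n → Fin n → Set
Edge H u w = adj H u w ≡ true
NonEdge H u w = adj H u w ≡ false

module _ {n} (H : Graph n) where

  edge-sym : ∀ {u w} → Edge H u w → Edge H w u
  edge-sym {u} {w} = trans (adj-sym H w u)

  nonEdge-sym : ∀ {u w} → NonEdge H u w → NonEdge H w u
  nonEdge-sym {u} {w} = trans (adj-sym H w u)

  edge-nonEdge : ∀ {u w} → Edge H u w → ¬ NonEdge H u w
  edge-nonEdge e f with () ← trans (sym e) f

  edge⇒≢ : ∀ {u w} → Edge H u w → u ≢ w
  edge⇒≢ {u} e refl = edge-nonEdge e (adj-irrefl H u)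

  separated⇒≢ : ∀ {u w z} → Edge H u z → NonEdge H w z → u ≢ w
  separated⇒≢ e f refl = edge-nonEdge e f

  clique-edge : ∀ {R u w} → IsClique H R → u ∈ R → w ∈ R → u ≢ w → Edge H u w
  clique-edge R-clique = proj₁ R-clique _ _

  clique-maximal : ∀ {R w} → IsClique H R → (∀ u → u ∈ R → w ≢ u → Edge H w u) → w ∈ R
  clique-maximal {R} {w} (_ , maximal) adjacent with w ∈? R
  ... | yes w∈R = w∈R
  ... | no w∉R = ⊥-elim (maximal w w∉R λ u u∈R → adjacent u u∈R λ { refl → w∉R u∈R })

clawFree-resp : ∀ {n} {H K : Graph n} → SameGraph H K → ClawFree K → ClawFree H
clawFree-resp {H = H} {K} H≡K cf c p q r cp cq cr p≢q p≢r q≢r pq pr qr =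
  cf c p q r (to cp) (to cq) (to cr) p≢q p≢r q≢r (to pq) (to pr) (to qr)
  where
  to : ∀ {u w b} → adj H u w ≡ b → adj K u w ≡ b
  to {u} {w} = trans (sym (H≡K u w))

module Path where

  private
    variable
      n : ℕ
      H H′ : Graph n
      P P′ : Fin n → Set
      u w z : Fin n

  start : PathIn H P u w → P u
  start (here p) = p
  start (there p _ _) = p

  _++_ : PathIn H P u w → PathIn H P w z → PathIn H P u z
  here _ ++ s = s
  there p e r ++ s = there p e (r ++ s)

  reverse : PathIn H P u w → PathIn H P w u
  reverse (here p) = here p
  reverse {H = H} (there p e r) = reverse r ++ there (start r) (edge-sym H e) (here p)

  map : (∀ {x} → P x → P′ x) → (∀ {x y} → Edge H x y → Edge H′ x y) → PathIn H P u w → PathIn H′ P′ u w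
  map f g (here p) = here (f p)
  map f g (there p e r) = there (f p) (g e) (map f g r)

module LocalCompletion {n} {H H′ : Graph n} {v : Fin n}
                       (H′≡ : SameGraph H′ (localCompletion H v)) where

  private
    added : Fin n → Fin n → Bool
    added u w = not ⌊ u ≟ w ⌋ ∧ (adj H v u ∧ adj H v w)

  edge-kept : ∀ {u w} → Edge H u w → Edge H′ u w
  edge-kept {u} {w} e = trans (H′≡ u w) (cong (_∨ added u w) e)

  nonEdge-reflected : ∀ {u w} → NonEdge H′ u w → NonEdge H u w
  nonEdge-reflected {u} {w} f = ∨-conicalˡ _ _ (trans (sym (H′≡ u w)) f)

  new-edge-in-nbhd : ∀ {u w} → Edge H′ u w → NonEdge H u w → Nbr H v u × Nbr H v w
  new-edge-in-nbhd {u} {w} e f = ∧-conicalˡ _ _ vu∧vw , ∧-conicalʳ _ _ vu∧vw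
    where
    vu∧vw : adj H v u ∧ adj H v w ≡ true
    vu∧vw = ∧-conicalʳ (not ⌊ u ≟ w ⌋) _ (trans (cong (_∨ added u w) (sym f)) (trans (sym (H′≡ u w)) e))

  nbhd-completed : ∀ {u w} → u ≢ w → Nbr H v u → Nbr H v w → Edge H′ u w
  nbhd-completed {u} {w} u≢w vu vw = begin
    adj H′ u w                                             ≡⟨ H′≡ u w ⟩
    adj H u w ∨ added u w                                  ≡⟨ cong₂ (λ b c → adj H u w ∨ (not b ∧ c))
                                                                     u≟w≡no (cong₂ _∧_ vu vw) ⟩
    adj H u w ∨ true                                       ≡⟨ ∨-zeroʳ (adj H u w) ⟩
    true                                                   ∎
    where
    open ≡-Reasoning
    u≟w≡no : ⌊ u ≟ w ⌋ ≡ false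
    u≟w≡no = trans (isYes≗does (u ≟ w)) (dec-false (u ≟ w) u≢w)

  nonEdge-leaves-nbhd : ∀ {u w} → NonEdge H′ u w → u ≢ w → Nbr H v u → NonEdge H v w
  nonEdge-leaves-nbhd {w = w} f u≢w vu with adj H v w in vw
  ... | true = ⊥-elim (edge-nonEdge H′ (nbhd-completed u≢w vu vw) f)
  ... | false = refl

  edge-reflectedʳ : ∀ {u w} → Edge H′ u w → NonEdge H v w → Edge H u w
  edge-reflectedʳ {u} {w} e vw with adj H u w in uw
  ... | true = refl
  ... | false = ⊥-elim (edge-nonEdge H (proj₂ (new-edge-in-nbhd e uw)) vw)

  edge-reflectedˡ : ∀ {u w} → Edge H′ u w → NonEdge H v u → Edge H u w
  edge-reflectedˡ e vu = edge-sym H (edge-reflectedʳ (edge-sym H′ e) vu)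

  private
    claw-at-new-edge : ClawFree H → ∀ c p q r → Edge H′ c p → Edge H′ c q → Edge H′ c r →
      p ≢ q → p ≢ r → q ≢ r → NonEdge H′ p q → NonEdge H′ p r → NonEdge H′ q r → NonEdge H c p → ⊥
    claw-at-new-edge cf c p q r cp cq cr p≢q p≢r q≢r pq pr qr cp∉H =
      cf c v q r (edge-sym H vc) (edge-reflectedʳ cq vq) (edge-reflectedʳ cr vr)
         (separated⇒≢ H vp (nonEdge-sym H (nonEdge-reflected pq)))
         (separated⇒≢ H vp (nonEdge-sym H (nonEdge-reflected pr)))
         q≢r vq vr (nonEdge-reflected qr)
      where
      vc = proj₁ (new-edge-in-nbhd cp cp∉H)
      vp = proj₂ (new-edge-in-nbhd cp cp∉H)
      vq = nonEdge-leaves-nbhd pq p≢q vp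
      vr = nonEdge-leaves-nbhd pr p≢r vp

  clawFree-preserved : ClawFree H → ClawFree H′
  clawFree-preserved cf c p q r cp cq cr p≢q p≢r q≢r pq pr qr
    with adj H c p in cp∈H | adj H c q in cq∈H | adj H c r in cr∈H
  ... | false | _ | _ = claw-at-new-edge cf c p q r cp cq cr p≢q p≢r q≢r pq pr qr cp∈H
  ... | true | false | _ =
    claw-at-new-edge cf c q p r cq cp cr (≢-sym p≢q) q≢r p≢r (nonEdge-sym H′ pq) qr pr cq∈H
  ... | true | true | false =
    claw-at-new-edge cf c r p q cr cp cq (≢-sym p≢r) (≢-sym q≢r) p≢q
      (nonEdge-sym H′ pr) (nonEdge-sym H′ qr) pq cr∈H
  ... | true | true | true =
    cf c p q r cp∈H cq∈H cr∈H p≢q p≢r q≢r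
      (nonEdge-reflected pq) (nonEdge-reflected pr) (nonEdge-reflected qr)

  locallyConnected-preserved : ∀ {u} → LocallyConnected H u → LocallyConnected H′ u
  locallyConnected-preserved {u} lc p q up uq with adj H v u in vu
  ... | true = to-v p up Path.++ Path.reverse (to-v q uq)
    where
    to-v : ∀ z → Nbr H′ u z → PathIn H′ (Nbr H′ u) z v
    to-v z uz with adj H u z in uz∈H
    ... | true = Path.map edge-kept edge-kept (lc z v uz∈H (edge-sym H vu))
    ... | false = there uz (edge-kept (edge-sym H (proj₂ (new-edge-in-nbhd uz uz∈H))))
                           (here (edge-kept (edge-sym H vu)))
  ... | false = Path.map edge-kept edge-kept (lc p q (edge-reflectedˡ up vu) (edge-reflectedˡ uq vu))

module ClosedClawFree {n} {C : Graph n} (cf : ClawFree C) (closed : Closed C) where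

  simplicial : ∀ {s u w} → LocallyConnected C s → Nbr C s u → Nbr C s w → u ≢ w → Edge C u w
  simplicial {s} {u} {w} lc su sw u≢w with adj C u w in uw
  ... | true = refl
  ... | false = ⊥-elim (closed s (lc , λ complete → edge-nonEdge C (complete u w su sw u≢w) uw))

  -- By claw-freeness every neighbour of z is adjacent to u or w (or is one of them),
  -- so G[N(z)] is connected through m and z would be eligible.
  no-induced-diamond : ∀ {z m u w} → Edge C z m → Edge C z u → Edge C z w →
    Edge C m u → Edge C m w → NonEdge C u w → u ≢ w → ⊥
  no-induced-diamond {z} {m} {u} {w} zm zu zw mu mw uw u≢w =
    edge-nonEdge C (simplicial locally-connected zu zw u≢w) uw
    where
    to-m : ∀ p → Nbr C z p → PathIn C (Nbr C z) p m
    to-m p zp with p ≟ u | p ≟ w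
    ... | yes refl | _ = there zp (edge-sym C mu) (here zm)
    ... | no _ | yes refl = there zp (edge-sym C mw) (here zm)
    ... | no p≢u | no p≢w with adj C p u in pu | adj C p w in pw
    ...   | true | _ = there zp pu (there zu (edge-sym C mu) (here zm))
    ...   | false | true = there zp pw (there zw (edge-sym C mw) (here zm))
    ...   | false | false = ⊥-elim (cf z p u w zp zu zw p≢u p≢w u≢w pu pw uw)

    locally-connected : LocallyConnected C z
    locally-connected p q zp zq = to-m p zp Path.++ Path.reverse (to-m q zq)

  clique-∋-nbr : ∀ {R s w} → IsClique C R → s ∈ R → LocallyConnected C s → Edge C s w → w ∈ R
  clique-∋-nbr {R} {s} {w} R-clique s∈R lc sw = clique-maximal C R-clique adjacent
    where
    adjacent : ∀ u → u ∈ R → w ≢ u → Edge C w u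
    adjacent u u∈R w≢u with u ≟ s
    ... | yes refl = edge-sym C sw
    ... | no u≢s = simplicial lc sw (clique-edge C R-clique s∈R u∈R (≢-sym u≢s)) w≢u

  clique-∋-common-nbr : ∀ {R x y w} → IsClique C R → x ∈ R → y ∈ R → Edge C x y →
    Edge C w x → Edge C w y → w ∈ R
  clique-∋-common-nbr {R} {x} {y} {w} R-clique x∈R y∈R xy wx wy = clique-maximal C R-clique adjacent
    where
    adjacent : ∀ u → u ∈ R → w ≢ u → Edge C w u
    adjacent u u∈R w≢u with u ≟ x | u ≟ y
    ... | yes refl | _ = wx
    ... | no _ | yes refl = wy
    ... | no u≢x | no u≢y with adj C w u in wu
    ...   | true = refl
    ...   | false = ⊥-elim (no-induced-diamond xy (edge-sym C wx)
                              (clique-edge C R-clique x∈R u∈R (≢-sym u≢x)) (edge-sym C wy)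
                              (clique-edge C R-clique y∈R u∈R (≢-sym u≢y)) wu w≢u)

-- IsNet without its distinctness conditions, which follow from the adjacencies.
record Net {n} (H : Graph n) (a₁ a₂ a₃ b₁ b₂ b₃ : Fin n) : Set where
  field
    a₁a₂ : Edge H a₁ a₂
    a₂a₃ : Edge H a₂ a₃
    a₃a₁ : Edge H a₃ a₁
    a₁b₁ : Edge H a₁ b₁
    a₂b₂ : Edge H a₂ b₂
    a₃b₃ : Edge H a₃ b₃
    a₁b₂ : NonEdge H a₁ b₂
    a₁b₃ : NonEdge H a₁ b₃
    a₂b₁ : NonEdge H a₂ b₁
    a₂b₃ : NonEdge H a₂ b₃
    a₃b₁ : NonEdge H a₃ b₁
    a₃b₂ : NonEdge H a₃ b₂
    b₁b₂ : NonEdge H b₁ b₂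
    b₁b₃ : NonEdge H b₁ b₃
    b₂b₃ : NonEdge H b₂ b₃

  a₁≢a₂ : a₁ ≢ a₂
  a₁≢a₂ = edge⇒≢ H a₁a₂
  a₁≢a₃ : a₁ ≢ a₃
  a₁≢a₃ = ≢-sym (edge⇒≢ H a₃a₁)
  a₂≢a₃ : a₂ ≢ a₃
  a₂≢a₃ = edge⇒≢ H a₂a₃
  b₁≢b₂ : b₁ ≢ b₂
  b₁≢b₂ = separated⇒≢ H (edge-sym H a₁b₁) (nonEdge-sym H a₁b₂)
  b₁≢b₃ : b₁ ≢ b₃
  b₁≢b₃ = separated⇒≢ H (edge-sym H a₁b₁) (nonEdge-sym H a₁b₃)
  b₂≢b₃ : b₂ ≢ b₃
  b₂≢b₃ = separated⇒≢ H (edge-sym H a₂b₂) (nonEdge-sym H a₂b₃)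
  a₁≢b₁ : a₁ ≢ b₁
  a₁≢b₁ = edge⇒≢ H a₁b₁
  a₁≢b₂ : a₁ ≢ b₂
  a₁≢b₂ = separated⇒≢ H (edge-sym H a₃a₁) (nonEdge-sym H a₃b₂)
  a₁≢b₃ : a₁ ≢ b₃
  a₁≢b₃ = separated⇒≢ H a₁a₂ (nonEdge-sym H a₂b₃)
  a₂≢b₁ : a₂ ≢ b₁
  a₂≢b₁ = separated⇒≢ H a₂a₃ (nonEdge-sym H a₃b₁)
  a₂≢b₂ : a₂ ≢ b₂
  a₂≢b₂ = edge⇒≢ H a₂b₂
  a₂≢b₃ : a₂ ≢ b₃
  a₂≢b₃ = separated⇒≢ H (edge-sym H a₁a₂) (nonEdge-sym H a₁b₃)
  a₃≢b₁ : a₃ ≢ b₁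
  a₃≢b₁ = separated⇒≢ H (edge-sym H a₂a₃) (nonEdge-sym H a₂b₁)
  a₃≢b₂ : a₃ ≢ b₂
  a₃≢b₂ = separated⇒≢ H a₃a₁ (nonEdge-sym H a₁b₂)
  a₃≢b₃ : a₃ ≢ b₃
  a₃≢b₃ = edge⇒≢ H a₃b₃

module _ {n} {H : Graph n} {a₁ a₂ a₃ b₁ b₂ b₃ : Fin n} where

  Net⇒IsNet : Net H a₁ a₂ a₃ b₁ b₂ b₃ → IsNet H a₁ a₂ a₃ b₁ b₂ b₃
  Net⇒IsNet N =
    a₁≢a₂ , a₁≢a₃ , a₂≢a₃ , b₁≢b₂ , b₁≢b₃ , b₂≢b₃ ,
    a₁≢b₁ , a₁≢b₂ , a₁≢b₃ , a₂≢b₁ , a₂≢b₂ , a₂≢b₃ , a₃≢b₁ , a₃≢b₂ , a₃≢b₃ ,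
    a₁a₂ , a₂a₃ , a₃a₁ , a₁b₁ , a₂b₂ , a₃b₃ ,
    a₁b₂ , a₁b₃ , a₂b₁ , a₂b₃ , a₃b₁ , a₃b₂ , b₁b₂ , b₁b₃ , b₂b₃
    where open Net N

  IsNet⇒Net : IsNet H a₁ a₂ a₃ b₁ b₂ b₃ → Net H a₁ a₂ a₃ b₁ b₂ b₃
  IsNet⇒Net (_ , _ , _ , _ , _ , _ , _ , _ , _ , _ , _ , _ , _ , _ , _ ,
             a₁a₂ , a₂a₃ , a₃a₁ , a₁b₁ , a₂b₂ , a₃b₃ ,
             a₁b₂ , a₁b₃ , a₂b₁ , a₂b₃ , a₃b₁ , a₃b₂ , b₁b₂ , b₁b₃ , b₂b₃) = record
    { a₁a₂ = a₁a₂ ; a₂a₃ = a₂a₃ ; a₃a₁ = a₃a₁ ; a₁b₁ = a₁b₁ ; a₂b₂ = a₂b₂ ; a₃b₃ = a₃b₃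
    ; a₁b₂ = a₁b₂ ; a₁b₃ = a₁b₃ ; a₂b₁ = a₂b₁ ; a₂b₃ = a₂b₃ ; a₃b₁ = a₃b₁ ; a₃b₂ = a₃b₂
    ; b₁b₂ = b₁b₂ ; b₁b₃ = b₁b₃ ; b₂b₃ = b₂b₃ }

  rotateNet : Net H a₁ a₂ a₃ b₁ b₂ b₃ → Net H a₂ a₃ a₁ b₂ b₃ b₁
  rotateNet N = record
    { a₁a₂ = a₂a₃ ; a₂a₃ = a₃a₁ ; a₃a₁ = a₁a₂ ; a₁b₁ = a₂b₂ ; a₂b₂ = a₃b₃ ; a₃b₃ = a₁b₁
    ; a₁b₂ = a₂b₃ ; a₁b₃ = a₂b₁ ; a₂b₁ = a₃b₂ ; a₂b₃ = a₃b₁ ; a₃b₁ = a₁b₂ ; a₃b₂ = a₁b₃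
    ; b₁b₂ = b₂b₃ ; b₁b₃ = nonEdge-sym H b₁b₂ ; b₂b₃ = nonEdge-sym H b₁b₃ }
    where open Net N

record NetWithin {n} (H : Graph n) (A₁ A₂ A₃ B₁ B₂ B₃ : Fin n → Set) : Set where
  constructor netWithin
  field
    {a₁ a₂ a₃ b₁ b₂ b₃} : Fin n
    net : Net H a₁ a₂ a₃ b₁ b₂ b₃
    a₁∈A₁ : A₁ a₁
    a₂∈A₂ : A₂ a₂
    a₃∈A₃ : A₃ a₃
    b₁∈B₁ : B₁ b₁
    b₂∈B₂ : B₂ b₂
    b₃∈B₃ : B₃ b₃

rotate : ∀ {n} {H : Graph n} {A₁ A₂ A₃ B₁ B₂ B₃} →
  NetWithin H A₁ A₂ A₃ B₁ B₂ B₃ → NetWithin H A₂ A₃ A₁ B₂ B₃ B₁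
rotate N = netWithin (rotateNet net) a₂∈A₂ a₃∈A₃ a₁∈A₁ b₂∈B₂ b₃∈B₃ b₁∈B₁
  where open NetWithin N

-- The two ways in which v may enter a net at position 1: replacing the pendant
-- vertex b₁, or replacing the triangle vertex a₁, which then becomes the pendant vertex.
record Replaceable {n} (H : Graph n) (v : Fin n) (A₁ A₂ A₃ B₁ : Fin n → Set) : Set where
  field
    pendant : ∀ {a b} → Nbr H v a → Nbr H v b → a ≢ b → A₁ a → B₁ b → B₁ v
    apex : ∀ {a₁ a₂ a₃} → Nbr H v a₁ → Nbr H v a₂ → Nbr H v a₃ →
      A₁ a₁ → A₂ a₂ → A₃ a₃ → NonEdge H a₁ a₂ → A₁ v × B₁ a₁

Admissible : ∀ {n} → Graph n → Fin n → (A₁ A₂ A₃ B₁ B₂ B₃ : Fin n → Set) → Set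
Admissible H v A₁ A₂ A₃ B₁ B₂ B₃ =
  Replaceable H v A₁ A₂ A₃ B₁ × Replaceable H v A₂ A₃ A₁ B₂ × Replaceable H v A₃ A₁ A₂ B₃

module PullBack {n} {H H′ : Graph n} {v : Fin n}
                (H′≡ : SameGraph H′ (localCompletion H v)) (cf : ClawFree H) where

  open LocalCompletion {H = H} {H′} {v} H′≡
  open NetWithin using (a₁; a₂; a₃; b₁; b₂; b₃)

  private
    variable
      A₁ A₂ A₃ B₁ B₂ B₃ : Fin n → Set
      x₁ x₂ x₃ y₁ y₂ y₃ : Fin n

  net-reflected : Net H′ x₁ x₂ x₃ y₁ y₂ y₃ →
    Edge H x₁ x₂ → Edge H x₂ x₃ → Edge H x₃ x₁ → Edge H x₁ y₁ → Edge H x₂ y₂ → Edge H x₃ y₃ →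
    Net H x₁ x₂ x₃ y₁ y₂ y₃
  net-reflected N x₁x₂ x₂x₃ x₃x₁ x₁y₁ x₂y₂ x₃y₃ = record
    { a₁a₂ = x₁x₂ ; a₂a₃ = x₂x₃ ; a₃a₁ = x₃x₁ ; a₁b₁ = x₁y₁ ; a₂b₂ = x₂y₂ ; a₃b₃ = x₃y₃
    ; a₁b₂ = nonEdge-reflected a₁b₂ ; a₁b₃ = nonEdge-reflected a₁b₃ ; a₂b₁ = nonEdge-reflected a₂b₁
    ; a₂b₃ = nonEdge-reflected a₂b₃ ; a₃b₁ = nonEdge-reflected a₃b₁ ; a₃b₂ = nonEdge-reflected a₃b₂
    ; b₁b₂ = nonEdge-reflected b₁b₂ ; b₁b₃ = nonEdge-reflected b₁b₃ ; b₂b₃ = nonEdge-reflected b₂b₃ }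
    where open Net N

  lone-new-triangle-edge : Net H′ x₁ x₂ x₃ y₁ y₂ y₃ →
    NonEdge H x₁ x₂ → Edge H x₂ x₃ → Edge H x₃ x₁ → Edge H x₃ y₃ → ⊥
  lone-new-triangle-edge N x₁x₂∉H x₂x₃∈H x₃x₁∈H x₃y₃∈H =
    cf _ _ _ _ x₃x₁∈H (edge-sym H x₂x₃∈H) x₃y₃∈H a₁≢a₂ a₁≢b₃ a₂≢b₃
       x₁x₂∉H (nonEdge-reflected a₁b₃) (nonEdge-reflected a₂b₃)
    where open Net N

  triangle-not-all-new : Net H′ x₁ x₂ x₃ y₁ y₂ y₃ →
    NonEdge H x₁ x₂ → NonEdge H x₂ x₃ → NonEdge H x₃ x₁ → ⊥
  triangle-not-all-new N x₁x₂∉H x₂x₃∉H x₃x₁∉H =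
    cf v _ _ _ (proj₁ (new-edge-in-nbhd a₁a₂ x₁x₂∉H)) (proj₂ (new-edge-in-nbhd a₁a₂ x₁x₂∉H))
       (proj₁ (new-edge-in-nbhd a₃a₁ x₃x₁∉H)) a₁≢a₂ a₁≢a₃ a₂≢a₃
       x₁x₂∉H (nonEdge-sym H x₃x₁∉H) x₂x₃∉H
    where open Net N

  -- v is adjacent to a₁ and b₁ and, N being induced in H′, to no other vertex of N.
  replace-pendant : Replaceable H v A₁ A₂ A₃ B₁ → (N : NetWithin H′ A₁ A₂ A₃ B₁ B₂ B₃) →
    NonEdge H (a₁ N) (b₁ N) → NetWithin H A₁ A₂ A₃ B₁ B₂ B₃
  replace-pendant r N a₁b₁∉H =
    netWithin net′ a₁∈A₁ a₂∈A₂ a₃∈A₃ (Replaceable.pendant r va₁ vb₁ a₁≢b₁ a₁∈A₁ b₁∈B₁) b₂∈B₂ b₃∈B₃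
    where
    open NetWithin N using (a₁∈A₁; a₂∈A₂; a₃∈A₃; b₁∈B₁; b₂∈B₂; b₃∈B₃)
    open Net (NetWithin.net N)
    va₁ = proj₁ (new-edge-in-nbhd a₁b₁ a₁b₁∉H)
    vb₁ = proj₂ (new-edge-in-nbhd a₁b₁ a₁b₁∉H)
    va₂ = nonEdge-leaves-nbhd (nonEdge-sym H′ a₂b₁) (≢-sym a₂≢b₁) vb₁
    va₃ = nonEdge-leaves-nbhd (nonEdge-sym H′ a₃b₁) (≢-sym a₃≢b₁) vb₁
    net′ : Net H (a₁ N) (a₂ N) (a₃ N) v (b₂ N) (b₃ N)
    net′ = record
      { a₁a₂ = edge-reflectedʳ a₁a₂ va₂ ; a₂a₃ = edge-reflectedʳ a₂a₃ va₃
      ; a₃a₁ = edge-reflectedˡ a₃a₁ va₃ ; a₁b₁ = edge-sym H va₁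
      ; a₂b₂ = edge-reflectedˡ a₂b₂ va₂ ; a₃b₃ = edge-reflectedˡ a₃b₃ va₃
      ; a₁b₂ = nonEdge-reflected a₁b₂ ; a₁b₃ = nonEdge-reflected a₁b₃
      ; a₂b₁ = nonEdge-sym H va₂ ; a₂b₃ = nonEdge-reflected a₂b₃
      ; a₃b₁ = nonEdge-sym H va₃ ; a₃b₂ = nonEdge-reflected a₃b₂
      ; b₁b₂ = nonEdge-leaves-nbhd b₁b₂ b₁≢b₂ vb₁ ; b₁b₃ = nonEdge-leaves-nbhd b₁b₃ b₁≢b₃ vb₁
      ; b₂b₃ = nonEdge-reflected b₂b₃ }

  -- v is adjacent to a₁, a₂, a₃ (both triangle edges at a₁ being new) and to no bⱼ.
  replace-apex : Replaceable H v A₁ A₂ A₃ B₁ → (N : NetWithin H′ A₁ A₂ A₃ B₁ B₂ B₃) →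
    Edge H (a₂ N) (b₂ N) → Edge H (a₃ N) (b₃ N) →
    NonEdge H (a₁ N) (a₂ N) → Edge H (a₂ N) (a₃ N) → NonEdge H (a₃ N) (a₁ N) →
    NetWithin H A₁ A₂ A₃ B₁ B₂ B₃
  replace-apex r N a₂b₂∈H a₃b₃∈H a₁a₂∉H a₂a₃∈H a₃a₁∉H =
    netWithin net′ (proj₁ v-replaces-a₁) a₂∈A₂ a₃∈A₃ (proj₂ v-replaces-a₁) b₂∈B₂ b₃∈B₃
    where
    open NetWithin N using (a₁∈A₁; a₂∈A₂; a₃∈A₃; b₁∈B₁; b₂∈B₂; b₃∈B₃)
    open Net (NetWithin.net N)
    va₁ = proj₁ (new-edge-in-nbhd a₁a₂ a₁a₂∉H)
    va₂ = proj₂ (new-edge-in-nbhd a₁a₂ a₁a₂∉H)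
    va₃ = proj₁ (new-edge-in-nbhd a₃a₁ a₃a₁∉H)
    v-replaces-a₁ = Replaceable.apex r va₁ va₂ va₃ a₁∈A₁ a₂∈A₂ a₃∈A₃ a₁a₂∉H
    net′ : Net H v (a₂ N) (a₃ N) (a₁ N) (b₂ N) (b₃ N)
    net′ = record
      { a₁a₂ = va₂ ; a₂a₃ = a₂a₃∈H ; a₃a₁ = edge-sym H va₃
      ; a₁b₁ = va₁ ; a₂b₂ = a₂b₂∈H ; a₃b₃ = a₃b₃∈H
      ; a₁b₂ = nonEdge-leaves-nbhd a₁b₂ a₁≢b₂ va₁ ; a₁b₃ = nonEdge-leaves-nbhd a₁b₃ a₁≢b₃ va₁
      ; a₂b₁ = nonEdge-sym H a₁a₂∉H ; a₂b₃ = nonEdge-reflected a₂b₃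
      ; a₃b₁ = a₃a₁∉H ; a₃b₂ = nonEdge-reflected a₃b₂
      ; b₁b₂ = nonEdge-reflected a₁b₂ ; b₁b₃ = nonEdge-reflected a₁b₃
      ; b₂b₃ = nonEdge-reflected b₂b₃ }

  private
    -- The triangle of N misses none or two edges of H: one or three would give a claw in H.
    pull-back-with-old-pendants : Admissible H v A₁ A₂ A₃ B₁ B₂ B₃ →
      (N : NetWithin H′ A₁ A₂ A₃ B₁ B₂ B₃) →
      Edge H (a₁ N) (b₁ N) → Edge H (a₂ N) (b₂ N) → Edge H (a₃ N) (b₃ N) →
      NetWithin H A₁ A₂ A₃ B₁ B₂ B₃
    pull-back-with-old-pendants (r₁ , r₂ , r₃) N e₁ e₂ e₃
      with adj H (a₁ N) (a₂ N) in m₁₂ | adj H (a₂ N) (a₃ N) in m₂₃ | adj H (a₃ N) (a₁ N) in m₃₁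
    ... | true  | true  | true  =
      netWithin (net-reflected (NetWithin.net N) m₁₂ m₂₃ m₃₁ e₁ e₂ e₃)
                a₁∈A₁ a₂∈A₂ a₃∈A₃ b₁∈B₁ b₂∈B₂ b₃∈B₃
      where open NetWithin N using (a₁∈A₁; a₂∈A₂; a₃∈A₃; b₁∈B₁; b₂∈B₂; b₃∈B₃)
    ... | false | true  | true  = ⊥-elim (lone-new-triangle-edge (NetWithin.net N) m₁₂ m₂₃ m₃₁ e₃)
    ... | true  | false | true  =
      ⊥-elim (lone-new-triangle-edge (rotateNet (NetWithin.net N)) m₂₃ m₃₁ m₁₂ e₁)
    ... | true  | true  | false =
      ⊥-elim (lone-new-triangle-edge (rotateNet (rotateNet (NetWithin.net N))) m₃₁ m₁₂ m₂₃ e₂)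
    ... | false | false | false = ⊥-elim (triangle-not-all-new (NetWithin.net N) m₁₂ m₂₃ m₃₁)
    ... | false | true  | false = replace-apex r₁ N e₂ e₃ m₁₂ m₂₃ m₃₁
    ... | false | false | true  = rotate (rotate (replace-apex r₂ (rotate N) e₃ e₁ m₂₃ m₃₁ m₁₂))
    ... | true  | false | false = rotate (replace-apex r₃ (rotate (rotate N)) e₁ e₂ m₃₁ m₁₂ m₂₃)

  pull-back : Admissible H v A₁ A₂ A₃ B₁ B₂ B₃ →
    NetWithin H′ A₁ A₂ A₃ B₁ B₂ B₃ → NetWithin H A₁ A₂ A₃ B₁ B₂ B₃
  pull-back adm@(r₁ , r₂ , r₃) N
    with adj H (a₁ N) (b₁ N) in e₁ | adj H (a₂ N) (b₂ N) in e₂ | adj H (a₃ N) (b₃ N) in e₃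
  ... | false | _     | _     = replace-pendant r₁ N e₁
  ... | true  | false | _     = rotate (rotate (replace-pendant r₂ (rotate N) e₂))
  ... | true  | true  | false = rotate (replace-pendant r₃ (rotate (rotate N)) e₃)
  ... | true  | true  | true  = pull-back-with-old-pendants adm N e₁ e₂ e₃

module ClosureSequence {n} {l} {Gs : Fin (suc l) → Graph n}
  (steps : ∀ i → LocalCompletionStep (Gs (inject₁ i)) (Gs (suc i))) where

  vertex : Fin l → Fin n
  vertex i = proj₁ (steps i)

  private
    completed : ∀ i → SameGraph (Gs (suc i)) (localCompletion (Gs (inject₁ i)) (vertex i))
    completed i = proj₂ (proj₂ (steps i))

    module Step (i : Fin l) = LocalCompletion {H = Gs (inject₁ i)} {Gs (suc i)} {vertex i} (completed i)

  clawFree-along : ClawFree (Gs zero) → ∀ i → ClawFree (Gs i)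
  clawFree-along cf₀ = <-weakInduction (λ i → ClawFree (Gs i)) cf₀ Step.clawFree-preserved

  edge-persists : ∀ {u w} → Edge (Gs zero) u w → ∀ i → Edge (Gs i) u w
  edge-persists {u} {w} e = <-weakInduction (λ i → Edge (Gs i) u w) e (λ i → Step.edge-kept i)

  edge-to-last : ∀ {u w} i → Edge (Gs i) u w → Edge (Gs (fromℕ l)) u w
  edge-to-last {u} {w} = >-weakInduction (λ i → Edge (Gs i) u w → Edge (Gs (fromℕ l)) u w)
    (λ e → e) (λ i to-last → to-last ∘ Step.edge-kept i)

  locallyConnected-to-last : ∀ {u} i → LocallyConnected (Gs i) u → LocallyConnected (Gs (fromℕ l)) u
  locallyConnected-to-last {u} =
    >-weakInduction (λ i → LocallyConnected (Gs i) u → LocallyConnected (Gs (fromℕ l)) u)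
      (λ lc → lc) (λ i to-last → to-last ∘ Step.locallyConnected-preserved i)

  vertex-locallyConnected : ∀ i → LocallyConnected (Gs (fromℕ l)) (vertex i)
  vertex-locallyConnected i = locallyConnected-to-last (inject₁ i) (proj₁ (proj₁ (proj₂ (steps i))))

  pull-back-along : ∀ {A₁ A₂ A₃ B₁ B₂ B₃} → ClawFree (Gs zero) →
    (∀ i → Admissible (Gs (inject₁ i)) (vertex i) A₁ A₂ A₃ B₁ B₂ B₃) →
    NetWithin (Gs (fromℕ l)) A₁ A₂ A₃ B₁ B₂ B₃ → ∀ i → NetWithin (Gs i) A₁ A₂ A₃ B₁ B₂ B₃
  pull-back-along {A₁} {A₂} {A₃} {B₁} {B₂} {B₃} cf₀ admissible N =
    >-weakInduction (λ i → NetWithin (Gs i) A₁ A₂ A₃ B₁ B₂ B₃) N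
      (λ i → PullBack.pull-back (completed i) (clawFree-along cf₀ (inject₁ i)) (admissible i))

module NetInClosure {n} {C : Graph n} (cf : ClawFree C) (closed : Closed C)
                    {R₀ : Subset n} (R₀-clique : IsClique C R₀) where

  open ClosedClawFree cf closed

  TriangleSet : Fin n → Fin n → Set
  TriangleSet x a = a ≡ x ⊎ (a ∈ R₀ × LocallyConnected C a)

  PendantSet : Fin n → Fin n → Subset n → Fin n → Set
  PendantSet x y R b = b ≡ x ⊎ b ≡ y ⊎ ((b ∈ R₀ ⊎ b ∈ R) × LocallyConnected C b)

  StrictPendantSet : Fin n → Subset n → Fin n → Set
  StrictPendantSet y R b = b ≡ y ⊎ (b ∈ R × LocallyConnected C b)

  triangleSet⊆pendantSet : ∀ {x y R a} → TriangleSet x a → PendantSet x y R a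
  triangleSet⊆pendantSet (inj₁ a≡x) = inj₁ a≡x
  triangleSet⊆pendantSet (inj₂ (a∈R₀ , lc)) = inj₂ (inj₂ (inj₁ a∈R₀ , lc))

  strictPendantSet⊆pendantSet : ∀ {x y R b} → StrictPendantSet y R b → PendantSet x y R b
  strictPendantSet⊆pendantSet (inj₁ b≡y) = inj₂ (inj₁ b≡y)
  strictPendantSet⊆pendantSet (inj₂ (b∈R , lc)) = inj₂ (inj₂ (inj₂ b∈R , lc))

  module Replacements {H : Graph n} (H⊆C : ∀ {u w} → Edge H u w → Edge C u w)
                      {v : Fin n} (v-lc : LocallyConnected C v) where

    private
      nbr-of-lc∈ : ∀ {R a} → IsClique C R → a ∈ R → LocallyConnected C a → Nbr H v a → v ∈ R
      nbr-of-lc∈ R-clique a∈R lc va = clique-∋-nbr R-clique a∈R lc (edge-sym C (H⊆C va))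

    weak-replaceable : ∀ {x x′ x″ y R} → IsClique C R → x ∈ R → y ∈ R → Edge C x y →
      x ∈ R₀ → x′ ∈ R₀ → Edge C x x′ →
      Replaceable H v (TriangleSet x) (TriangleSet x′) (TriangleSet x″) (PendantSet x y R)
    weak-replaceable {x} {x′} {y = y} {R} R-clique x∈R y∈R xy x∈R₀ x′∈R₀ xx′ = record
      { pendant = λ va vb a≢b a∈ b∈ → inj₂ (inj₂ (v∈R₀∪R va vb a≢b a∈ b∈ , v-lc))
      ; apex = λ va₁ va₂ _ a₁∈ a₂∈ _ _ →
          inj₂ (v∈R₀ va₁ va₂ a₁∈ a₂∈ , v-lc) , triangleSet⊆pendantSet a₁∈ }
      where
      v∈R₀∪R : ∀ {a b} → Nbr H v a → Nbr H v b → a ≢ b → TriangleSet x a → PendantSet x y R b →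
        v ∈ R₀ ⊎ v ∈ R
      v∈R₀∪R va _ _ (inj₂ (a∈R₀ , a-lc)) _ = inj₁ (nbr-of-lc∈ R₀-clique a∈R₀ a-lc va)
      v∈R₀∪R _ _ a≢b (inj₁ refl) (inj₁ refl) = ⊥-elim (a≢b refl)
      v∈R₀∪R va vb _ (inj₁ refl) (inj₂ (inj₁ refl)) =
        inj₂ (clique-∋-common-nbr R-clique x∈R y∈R xy (H⊆C va) (H⊆C vb))
      v∈R₀∪R _ vb _ (inj₁ refl) (inj₂ (inj₂ (inj₁ b∈R₀ , b-lc))) =
        inj₁ (nbr-of-lc∈ R₀-clique b∈R₀ b-lc vb)
      v∈R₀∪R _ vb _ (inj₁ refl) (inj₂ (inj₂ (inj₂ b∈R , b-lc))) =
        inj₂ (nbr-of-lc∈ R-clique b∈R b-lc vb)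

      v∈R₀ : ∀ {a a′} → Nbr H v a → Nbr H v a′ → TriangleSet x a → TriangleSet x′ a′ → v ∈ R₀
      v∈R₀ va _ (inj₂ (a∈R₀ , a-lc)) _ = nbr-of-lc∈ R₀-clique a∈R₀ a-lc va
      v∈R₀ _ va′ (inj₁ refl) (inj₂ (a′∈R₀ , a′-lc)) = nbr-of-lc∈ R₀-clique a′∈R₀ a′-lc va′
      v∈R₀ va va′ (inj₁ refl) (inj₁ refl) =
        clique-∋-common-nbr R₀-clique x∈R₀ x′∈R₀ xx′ (H⊆C va) (H⊆C va′)

    strict-replaceable : ∀ {x x′ x″ y R} → IsClique C R → x ∈ R → y ∈ R → Edge C x y → Edge H x x′ →
      Replaceable H v (_≡ x) (_≡ x′) (_≡ x″) (StrictPendantSet y R)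
    strict-replaceable {x} {y = y} {R} R-clique x∈R y∈R xy xx′ = record
      { pendant = λ va vb _ a≡x b∈ → inj₂ (v∈R va vb a≡x b∈ , v-lc)
      ; apex = λ { _ _ _ refl refl _ xx′∉H → ⊥-elim (edge-nonEdge H xx′ xx′∉H) } }
      where
      v∈R : ∀ {a b} → Nbr H v a → Nbr H v b → a ≡ x → StrictPendantSet y R b → v ∈ R
      v∈R va vb refl (inj₁ refl) = clique-∋-common-nbr R-clique x∈R y∈R xy (H⊆C va) (H⊆C vb)
      v∈R _ vb _ (inj₂ (b∈R , b-lc)) = nbr-of-lc∈ R-clique b∈R b-lc vb

  -- If a ≠ x then b, a neighbour of a ∈ R₀ ∩ LC, lies in R₀; a strict b would then put y
  -- or o into the clique of the other, contradicting o y ∉ E.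
  strictPendant⇒apex : ∀ {x y o R a b} → IsClique C R → y ∈ R → o ∈ R₀ → o ≢ y → NonEdge C o y →
    TriangleSet x a → Edge C a b → StrictPendantSet y R b → a ≡ x
  strictPendant⇒apex _ _ _ _ _ (inj₁ a≡x) _ _ = a≡x
  strictPendant⇒apex {y = y} {o} {R} {b = b} R-clique y∈R o∈R₀ o≢y oy (inj₂ (a∈R₀ , a-lc)) ab b∈ =
    ⊥-elim (excluded b∈)
    where
    b∈R₀ = clique-∋-nbr R₀-clique a∈R₀ a-lc ab
    o∉R : ¬ o ∈ R
    o∉R o∈R = edge-nonEdge C (clique-edge C R-clique o∈R y∈R o≢y) oy
    excluded : ¬ StrictPendantSet y R b
    excluded (inj₁ b≡y) =
      edge-nonEdge C (clique-edge C R₀-clique o∈R₀ (subst (_∈ R₀) b≡y b∈R₀) o≢y) oy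
    excluded (inj₂ (b∈R , b-lc)) =
      o∉R (clique-∋-nbr R-clique b∈R b-lc (clique-edge C R₀-clique b∈R₀ o∈R₀ λ { refl → o∉R b∈R }))

module NetsAlongClosureSequence {n} (G : Graph n) (cf : ClawFree G)
  (l : ℕ) (Gs : Fin (suc l) → Graph n) (G⁰≡G : SameGraph (Gs zero) G)
  (steps : ∀ (i : Fin l) → LocalCompletionStep (Gs (inject₁ i)) (Gs (suc i)))
  (closed : Closed (Gs (fromℕ l)))
  (x₁ x₂ x₃ y₁ y₂ y₃ : Fin n) (netˡ : IsNet (Gs (fromℕ l)) x₁ x₂ x₃ y₁ y₂ y₃)
  (R₀ R₁ R₂ R₃ : Subset n)
  (R₀-clique : IsClique (Gs (fromℕ l)) R₀)
  (x₁∈R₀ : x₁ ∈ R₀) (x₂∈R₀ : x₂ ∈ R₀) (x₃∈R₀ : x₃ ∈ R₀)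
  (R₁-clique : IsClique (Gs (fromℕ l)) R₁) (x₁∈R₁ : x₁ ∈ R₁) (y₁∈R₁ : y₁ ∈ R₁)
  (R₂-clique : IsClique (Gs (fromℕ l)) R₂) (x₂∈R₂ : x₂ ∈ R₂) (y₂∈R₂ : y₂ ∈ R₂)
  (R₃-clique : IsClique (Gs (fromℕ l)) R₃) (x₃∈R₃ : x₃ ∈ R₃) (y₃∈R₃ : y₃ ∈ R₃) where

  open ClosureSequence {Gs = Gs} steps

  private
    cf₀ : ClawFree (Gs zero)
    cf₀ = clawFree-resp {H = Gs zero} {G} G⁰≡G cf

    closure-net : Net (Gs (fromℕ l)) x₁ x₂ x₃ y₁ y₂ y₃
    closure-net = IsNet⇒Net netˡ

    open Net closure-net renaming
      (a₁a₂ to x₁x₂; a₂a₃ to x₂x₃; a₃a₁ to x₃x₁; a₁b₁ to x₁y₁; a₂b₂ to x₂y₂; a₃b₃ to x₃y₃;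
       a₂b₁ to x₂y₁; a₃b₂ to x₃y₂; a₁b₃ to x₁y₃; a₂≢b₁ to x₂≢y₁; a₃≢b₂ to x₃≢y₂; a₁≢b₃ to x₁≢y₃)

  open NetInClosure (clawFree-along cf₀ (fromℕ l)) closed R₀-clique public

  weakNets : ∀ i → NetWithin (Gs i) (TriangleSet x₁) (TriangleSet x₂) (TriangleSet x₃)
                                    (PendantSet x₁ y₁ R₁) (PendantSet x₂ y₂ R₂) (PendantSet x₃ y₃ R₃)
  weakNets = pull-back-along cf₀ admissible
    (netWithin closure-net (inj₁ refl) (inj₁ refl) (inj₁ refl)
                           (inj₂ (inj₁ refl)) (inj₂ (inj₁ refl)) (inj₂ (inj₁ refl)))
    where
    admissible : ∀ i → Admissible (Gs (inject₁ i)) (vertex i)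
      (TriangleSet x₁) (TriangleSet x₂) (TriangleSet x₃)
      (PendantSet x₁ y₁ R₁) (PendantSet x₂ y₂ R₂) (PendantSet x₃ y₃ R₃)
    admissible i =
      weak-replaceable R₁-clique x₁∈R₁ y₁∈R₁ x₁y₁ x₁∈R₀ x₂∈R₀ x₁x₂ ,
      weak-replaceable R₂-clique x₂∈R₂ y₂∈R₂ x₂y₂ x₂∈R₀ x₃∈R₀ x₂x₃ ,
      weak-replaceable R₃-clique x₃∈R₃ y₃∈R₃ x₃y₃ x₃∈R₀ x₁∈R₀ x₃x₁
      where open Replacements (edge-to-last (inject₁ i)) (vertex-locallyConnected i)

  strictNets : IsTriangle G x₁ x₂ x₃ →
    ∀ i → NetWithin (Gs i) (_≡ x₁) (_≡ x₂) (_≡ x₃)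
                           (StrictPendantSet y₁ R₁) (StrictPendantSet y₂ R₂) (StrictPendantSet y₃ R₃)
  strictNets (x₁x₂∈G , x₂x₃∈G , x₃x₁∈G) = pull-back-along cf₀ admissible
    (netWithin closure-net refl refl refl (inj₁ refl) (inj₁ refl) (inj₁ refl))
    where
    admissible : ∀ i → Admissible (Gs (inject₁ i)) (vertex i) (_≡ x₁) (_≡ x₂) (_≡ x₃)
      (StrictPendantSet y₁ R₁) (StrictPendantSet y₂ R₂) (StrictPendantSet y₃ R₃)
    admissible i =
      strict-replaceable R₁-clique x₁∈R₁ y₁∈R₁ x₁y₁ (persists x₁x₂∈G) ,
      strict-replaceable R₂-clique x₂∈R₂ y₂∈R₂ x₂y₂ (persists x₂x₃∈G) ,
      strict-replaceable R₃-clique x₃∈R₃ y₃∈R₃ x₃y₃ (persists x₃x₁∈G)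
      where
      open Replacements (edge-to-last (inject₁ i)) (vertex-locallyConnected i)
      persists : ∀ {u w} → Edge G u w → Edge (Gs (inject₁ i)) u w
      persists {u} {w} e = edge-persists (trans (G⁰≡G u w) e) (inject₁ i)

  strictPendants⇒triangle : ∀ {i} → toℕ i ≡ 0 →
    (N : NetWithin (Gs i) (TriangleSet x₁) (TriangleSet x₂) (TriangleSet x₃)
                          (PendantSet x₁ y₁ R₁) (PendantSet x₂ y₂ R₂) (PendantSet x₃ y₃ R₃)) →
    let open NetWithin N in
    StrictPendantSet y₁ R₁ b₁ → StrictPendantSet y₂ R₂ b₂ → StrictPendantSet y₃ R₃ b₃ →
    IsTriangle G x₁ x₂ x₃
  strictPendants⇒triangle {zero} _ (netWithin N a₁∈ a₂∈ a₃∈ _ _ _) s₁ s₂ s₃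
    with strictPendant⇒apex R₁-clique y₁∈R₁ x₂∈R₀ x₂≢y₁ x₂y₁ a₁∈ (edge-to-last zero a₁b₁) s₁
       | strictPendant⇒apex R₂-clique y₂∈R₂ x₃∈R₀ x₃≢y₂ x₃y₂ a₂∈ (edge-to-last zero a₂b₂) s₂
       | strictPendant⇒apex R₃-clique y₃∈R₃ x₁∈R₀ x₁≢y₃ x₁y₃ a₃∈ (edge-to-last zero a₃b₃) s₃
    where open Net N
  ... | refl | refl | refl = to-G a₁a₂ , to-G a₂a₃ , to-G a₃a₁
    where
    open Net N
    to-G : ∀ {u w} → Edge (Gs zero) u w → Edge G u w
    to-G {u} {w} = trans (sym (G⁰≡G u w))

lemma1 : ∀ {n} (G : Graph n) → ClawFree G →
    (l : ℕ) (Gs : Fin (suc l) → Graph n) →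
    SameGraph (Gs zero) G →
    (∀ (i : Fin l) → LocalCompletionStep (Gs (inject₁ i)) (Gs (suc i))) →
    -- G^l = cl(G): no eligible vertex remains
    Closed (Gs (fromℕ l)) →
    (x₁ x₂ x₃ y₁ y₂ y₃ : Fin n) →
    IsNet (Gs (fromℕ l)) x₁ x₂ x₃ y₁ y₂ y₃ →
    (R₀ R₁ R₂ R₃ : Subset n) →
    IsClique (Gs (fromℕ l)) R₀ → x₁ ∈ R₀ → x₂ ∈ R₀ → x₃ ∈ R₀ →
    IsClique (Gs (fromℕ l)) R₁ → x₁ ∈ R₁ → y₁ ∈ R₁ →
    IsClique (Gs (fromℕ l)) R₂ → x₂ ∈ R₂ → y₂ ∈ R₂ →
    IsClique (Gs (fromℕ l)) R₃ → x₃ ∈ R₃ → y₃ ∈ R₃ →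
    (i : Fin (suc l)) →
    Σ (Fin n) λ a₁ → Σ (Fin n) λ a₂ → Σ (Fin n) λ a₃ →
    Σ (Fin n) λ b₁ → Σ (Fin n) λ b₂ → Σ (Fin n) λ b₃ →
    IsNet (Gs i) a₁ a₂ a₃ b₁ b₂ b₃ ×
    -- (i)
    (a₁ ≡ x₁ ⊎ (a₁ ∈ R₀ × LocallyConnected (Gs (fromℕ l)) a₁)) ×
    (a₂ ≡ x₂ ⊎ (a₂ ∈ R₀ × LocallyConnected (Gs (fromℕ l)) a₂)) ×
    (a₃ ≡ x₃ ⊎ (a₃ ∈ R₀ × LocallyConnected (Gs (fromℕ l)) a₃)) ×
    (b₁ ≡ x₁ ⊎ b₁ ≡ y₁ ⊎ ((b₁ ∈ R₀ ⊎ b₁ ∈ R₁) × LocallyConnected (Gs (fromℕ l)) b₁)) ×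
    (b₂ ≡ x₂ ⊎ b₂ ≡ y₂ ⊎ ((b₂ ∈ R₀ ⊎ b₂ ∈ R₂) × LocallyConnected (Gs (fromℕ l)) b₂)) ×
    (b₃ ≡ x₃ ⊎ b₃ ≡ y₃ ⊎ ((b₃ ∈ R₀ ⊎ b₃ ∈ R₃) × LocallyConnected (Gs (fromℕ l)) b₃)) ×
    -- (ii), for the net N^0
    (toℕ i ≡ 0 →
      (IsTriangle G x₁ x₂ x₃ ⇔
        ((b₁ ≡ y₁ ⊎ (b₁ ∈ R₁ × LocallyConnected (Gs (fromℕ l)) b₁)) ×
         (b₂ ≡ y₂ ⊎ (b₂ ∈ R₂ × LocallyConnected (Gs (fromℕ l)) b₂)) ×
         (b₃ ≡ y₃ ⊎ (b₃ ∈ R₃ × LocallyConnected (Gs (fromℕ l)) b₃)))))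
lemma1 G cf l Gs G⁰≡G steps closed x₁ x₂ x₃ y₁ y₂ y₃ netˡ R₀ R₁ R₂ R₃
       R₀-clique x₁∈R₀ x₂∈R₀ x₃∈R₀ R₁-clique x₁∈R₁ y₁∈R₁ R₂-clique x₂∈R₂ y₂∈R₂ R₃-clique x₃∈R₃ y₃∈R₃ i =
  case triangle? of λ where
    (yes x₁x₂x₃) → let netWithin N a₁≡x₁ a₂≡x₂ a₃≡x₃ s₁ s₂ s₃ = strictNets x₁x₂x₃ i in
      _ , _ , _ , _ , _ , _ , Net⇒IsNet N , inj₁ a₁≡x₁ , inj₁ a₂≡x₂ , inj₁ a₃≡x₃ ,
      strictPendantSet⊆pendantSet s₁ , strictPendantSet⊆pendantSet s₂ , strictPendantSet⊆pendantSet s₃ ,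
      λ _ → mk⇔ (λ _ → s₁ , s₂ , s₃) (λ _ → x₁x₂x₃)
    (no ¬x₁x₂x₃) → let M = weakNets i ; netWithin N a₁∈ a₂∈ a₃∈ b₁∈ b₂∈ b₃∈ = M in
      _ , _ , _ , _ , _ , _ , Net⇒IsNet N , a₁∈ , a₂∈ , a₃∈ , b₁∈ , b₂∈ , b₃∈ ,
      λ i≡0 → mk⇔ (⊥-elim ∘ ¬x₁x₂x₃) (λ (s₁ , s₂ , s₃) → strictPendants⇒triangle i≡0 M s₁ s₂ s₃)
  where
  open NetsAlongClosureSequence G cf l Gs G⁰≡G steps closed x₁ x₂ x₃ y₁ y₂ y₃ netˡ R₀ R₁ R₂ R₃
    R₀-clique x₁∈R₀ x₂∈R₀ x₃∈R₀ R₁-clique x₁∈R₁ y₁∈R₁ R₂-clique x₂∈R₂ y₂∈R₂ R₃-clique x₃∈R₃ y₃∈R₃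

  triangle? : Dec (IsTriangle G x₁ x₂ x₃)
  triangle? = (adj G x₁ x₂ ≟ᵇ true) ×-dec (adj G x₂ x₃ ≟ᵇ true) ×-dec (adj G x₃ x₁ ≟ᵇ true)
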